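{- If $\alpha$ is an MVP parking function of length $n$ with $\mathcal{O}_{\mathrm{MVP}_n}(\alpha)=(n,n-1,\dots,2,1)$, then $\Phi(\alpha)\in\mathcal{M}_n$.
   Context: A Motzkin path of length $n$ is a lattice path from $(0,0)$ to $(n,0)$ with steps $(1,0)$, $(1,1)$, $(1,-1)$ that never goes below the $x$-axis; $\mathcal{M}_n$ is the set of them. Spots $1,\dots,n$ on a one-way street; cars $1,\dots,n$ arrive in order with preferences $\alpha=(a_1,\dots,a_n)\in[n]^n$. MVP parking rule: when car $i$ arrives, if spot $a_i$ is unoccupied, car $i$ parks there; if spot $a_i$ is occupied by an earlier car $j$, then car $i$ parks in spot $a_i$ and car $j$ is bumped and parks in the first unoccupied spot among $a_i+1,\dots,n$, if any (otherwise car $j$ fails to park); a bumped car never bumps another car. $\alpha$ is an MVP parking function if all cars park; its outcome $\mathcal{O}_{\mathrm{MVP}_n}(\alpha)$ is the permutation (in one-line notation) whose $j$th entry is the car parked in spot $j$. For $v=(v_1,\dots,v_n)\in[n]^n$, $\Phi(v)=\phi(1)\phi(2)\cdots\phi(n)$ is the lattice path starting at $(0,0)$ where, for each $j\in[n]$, $\phi(j)=D$ (step $(1,-1)$) if no $i$ has $v_i=j$, $\phi(j)=H$ (step $(1,0)$) if exactly one $i$ has $v_i=j$, and $\phi(j)=U$ (step $(1,1)$) if at least two $i$ have $v_i=j$. -}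

module Defs where

open import Data.Nat using (ℕ; zero; suc; _≤_; _≟_)
open import Data.List using (List; []; _∷_; length; map; upTo)
open import Data.Vec using (Vec; toList)
open import Data.Maybe using (Maybe; just; nothing; _>>=_)
open import Data.Product using (_×_; ∃)
open import Data.Empty using (⊥)
open import Relation.Nullary using (yes; no)
open import Relation.Binary.PropositionalEquality using (_≡_)

data Step : Set where
  U H D : Step     -- U = (1,1), H = (1,0), D = (1,-1)

StaysAboveEndsAt0 : ℕ → List Step → Set
StaysAboveEndsAt0 h [] = h ≡ 0
StaysAboveEndsAt0 h (U ∷ p) = StaysAboveEndsAt0 (suc h) p
StaysAboveEndsAt0 h (H ∷ p) = StaysAboveEndsAt0 h p
StaysAboveEndsAt0 zero (D ∷ p) = ⊥
StaysAboveEndsAt0 (suc h) (D ∷ p) = StaysAboveEndsAt0 h p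

InMotzkin : ℕ → List Step → Set
InMotzkin n p = length p ≡ n × StaysAboveEndsAt0 0 p

count : ℕ → List ℕ → ℕ
count j [] = 0
count j (x ∷ xs) with x ≟ j
... | yes _ = suc (count j xs)
... | no  _ = count j xs

φ : ℕ → Step
φ zero          = D
φ (suc zero)    = H
φ (suc (suc _)) = U

Φ : {n : ℕ} → Vec ℕ n → List Step
Φ {n} v = map (λ k → φ (count (suc k) (toList v))) (upTo n)

-- MVP parking.  Spots are 1-based; a configuration is a list of length n
-- whose k-th entry (k = 1..n) is `just c` if car c occupies spot k.

Config : Set
Config = List (Maybe ℕ)

occupant : Config → ℕ → Maybe ℕ
occupant [] a = nothing
occupant (x ∷ s) zero = nothing
occupant (x ∷ s) (suc zero) = x
occupant (x ∷ s) (suc (suc a)) = occupant s (suc a)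

setSpot : Config → ℕ → ℕ → Config
setSpot [] a c = []
setSpot (x ∷ s) zero c = x ∷ s
setSpot (x ∷ s) (suc zero) c = just c ∷ s
setSpot (x ∷ s) (suc (suc a)) c = x ∷ setSpot s (suc a) c

firstEmpty : ℕ → Config → Maybe Config
firstEmpty c [] = nothing
firstEmpty c (nothing ∷ s) = just (just c ∷ s)
firstEmpty c (just x ∷ s) = firstEmpty c s >>= λ s' → just (just x ∷ s')

firstEmptyAfter : ℕ → ℕ → Config → Maybe Config
firstEmptyAfter zero c s = firstEmpty c s
firstEmptyAfter (suc a) c [] = nothing
firstEmptyAfter (suc a) c (x ∷ s) = firstEmptyAfter a c s >>= λ s' → just (x ∷ s')

mvpStep : ℕ → ℕ → Config → Maybe Config
mvpStep i a s with occupant s a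
... | nothing = just (setSpot s a i)
... | just j  = firstEmptyAfter a j (setSpot s a i)

mvpRun : ℕ → List ℕ → Config → Maybe Config
mvpRun k [] s = just s
mvpRun k (a ∷ as) s = mvpStep k a s >>= mvpRun (suc k) as

emptyConfig : ℕ → Config
emptyConfig zero = []
emptyConfig (suc n) = nothing ∷ emptyConfig n

allFilled : Config → Maybe (List ℕ)
allFilled [] = just []
allFilled (nothing ∷ s) = nothing
allFilled (just c ∷ s) = allFilled s >>= λ l → just (c ∷ l)

-- 𝒪_MVP_n(α): `just π` if every car parks (π = outcome in one-line notation),
-- `nothing` if some car fails to park.
outcomeMVP : {n : ℕ} → Vec ℕ n → Maybe (List ℕ)
outcomeMVP {n} α = mvpRun 1 (toList α) (emptyConfig n) >>= allFilled

InRange : {n : ℕ} → Vec ℕ n → Set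
InRange {n} α = Data.List.Relation.Unary.All.All (λ a → 1 ≤ a × a ≤ n) (toList α)
  where import Data.List.Relation.Unary.All

IsMVPParkingFunction : {n : ℕ} → Vec ℕ n → Set
IsMVPParkingFunction α = InRange α × ∃ λ π → outcomeMVP α ≡ just π

decreasing : ℕ → List ℕ
decreasing zero = []
decreasing (suc n) = suc n ∷ decreasing n

module Submission where

-- A car only ever moves right, and under the outcome (n, …, 1) car i ends in spot n + 1 − i, so
-- a_i ≤ n + 1 − i. Hence at least k preferences are ≤ k, which keeps Φ(α) off the negative half
-- plane as long as no spot is preferred three times; since all preferences lie in [n] it ends at 0.
-- Cars after car T = n + 1 − j prefer spots below j. If two cars before T preferred j, the later one
-- bumped the earlier one into the occupied block starting at j; car T must then take spot j from
-- the newer of them, pushing it past that block, to the right of an older car, which the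
-- decreasing outcome forbids.

open import Defs
open import Data.Nat using (ℕ; zero; suc; _+_; _∸_; _≤_; _<_; z≤n; s≤s; z<s; _≟_; _≤?_)
open import Data.Nat.Properties
open import Data.Nat.ListAction using (sum)
open import Data.Nat.ListAction.Properties using (sum-++)
open import Data.List using (List; []; _∷_; length; applyUpTo; _++_; _∷ʳ_)
open import Data.List.Properties using (applyUpTo-∷ʳ; length-applyUpTo; map-upTo)
open import Data.Vec using (Vec; toList)
open import Data.Vec.Properties using (length-toList)
open import Data.Maybe using (Maybe; just; nothing; _>>=_)
open import Data.Maybe.Properties using (just-injective)
open import Data.Product using (_×_; _,_; ∃; proj₁; proj₂; map₂)
open import Data.List.Relation.Unary.All as All using (All; []; _∷_)
open import Data.Sum using (_⊎_; inj₁; inj₂)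
open import Data.Empty using (⊥-elim)
open import Data.Unit using (⊤; tt)
open import Function using (_∘_)
open import Relation.Nullary using (Dec; yes; no; ¬_; contradiction)
open import Relation.Binary.PropositionalEquality
  using (_≡_; _≢_; ≢-sym; refl; sym; trans; cong; cong₂; subst; subst₂; module ≡-Reasoning)

>>=-just : ∀ {A B : Set} (m : Maybe A) (f : A → Maybe B) {z : B} →
           (m >>= f) ≡ just z → ∃ λ w → m ≡ just w × f w ≡ just z
>>=-just (just w) f eq = w , refl , eq

Occupied : Config → ℕ → Set
Occupied s r = ∃ λ z → occupant s r ≡ just z

nothing≢just : ∀ {z : ℕ} → nothing ≢ just z
nothing≢just ()

occupant-∷ : ∀ x s {r} → 1 ≤ r → occupant (x ∷ s) (suc r) ≡ occupant s r
occupant-∷ x s {suc r} _ = refl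

occupant-setSpot-≡ : ∀ s a c → 1 ≤ a → a ≤ length s → occupant (setSpot s a c) a ≡ just c
occupant-setSpot-≡ (x ∷ s) (suc zero) c _ _ = refl
occupant-setSpot-≡ (x ∷ s) (suc (suc a)) c _ (s≤s a<∣s∣) =
  occupant-setSpot-≡ s (suc a) c (s≤s z≤n) a<∣s∣

occupant-setSpot-≢ : ∀ s a c r → r ≢ a → occupant (setSpot s a c) r ≡ occupant s r
occupant-setSpot-≢ [] a c r _ = refl
occupant-setSpot-≢ (x ∷ s) zero c r _ = refl
occupant-setSpot-≢ (x ∷ s) (suc zero) c zero _ = refl
occupant-setSpot-≢ (x ∷ s) (suc zero) c (suc zero) r≢a = ⊥-elim (r≢a refl)
occupant-setSpot-≢ (x ∷ s) (suc zero) c (suc (suc r)) _ = refl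
occupant-setSpot-≢ (x ∷ s) (suc (suc a)) c zero _ = refl
occupant-setSpot-≢ (x ∷ s) (suc (suc a)) c (suc zero) _ = refl
occupant-setSpot-≢ (x ∷ s) (suc (suc a)) c (suc (suc r)) r≢a =
  occupant-setSpot-≢ s (suc a) c (suc r) (λ r≡a → r≢a (cong suc r≡a))

length-setSpot : ∀ s a c → length (setSpot s a c) ≡ length s
length-setSpot [] a c = refl
length-setSpot (x ∷ s) zero c = refl
length-setSpot (x ∷ s) (suc zero) c = refl
length-setSpot (x ∷ s) (suc (suc a)) c = cong suc (length-setSpot s (suc a) c)

length-emptyConfig : ∀ n → length (emptyConfig n) ≡ n
length-emptyConfig zero = refl
length-emptyConfig (suc n) = cong suc (length-emptyConfig n)

occupant-emptyConfig : ∀ n r → occupant (emptyConfig n) r ≡ nothing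
occupant-emptyConfig zero r = refl
occupant-emptyConfig (suc n) zero = refl
occupant-emptyConfig (suc n) (suc zero) = refl
occupant-emptyConfig (suc zero) (suc (suc r)) = refl
occupant-emptyConfig (suc (suc n)) (suc (suc r)) = occupant-emptyConfig (suc n) (suc r)

record ParksAfter (a c : ℕ) (s s' : Config) : Set where
  field
    spot      : ℕ
    a<spot    : a < spot
    wasEmpty  : occupant s spot ≡ nothing
    parked    : occupant s' spot ≡ just c
    gapless   : ∀ r → a < r → r < spot → Occupied s r
    unchanged : ∀ r → r ≢ spot → occupant s' r ≡ occupant s r
    length≡   : length s' ≡ length s

ParksAfter-∷ : ∀ {a c s s'} x → ParksAfter a c s s' → ParksAfter (suc a) c (x ∷ s) (x ∷ s')
ParksAfter-∷ {a} {c} {s} {s'} x P = record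
  { spot = suc spot
  ; a<spot = s≤s a<spot
  ; wasEmpty = trans (occupant-∷ x s 1≤spot) wasEmpty
  ; parked = trans (occupant-∷ x s' 1≤spot) parked
  ; gapless = gapless′
  ; unchanged = unchanged′
  ; length≡ = cong suc length≡
  }
  where
  open ParksAfter P
  1≤spot : 1 ≤ spot
  1≤spot = ≤-trans (s≤s z≤n) a<spot
  gapless′ : ∀ r → suc a < r → r < suc spot → Occupied (x ∷ s) r
  gapless′ (suc r) (s≤s a<r) (s≤s r<spot) with gapless r a<r r<spot
  ... | z , eq = z , trans (occupant-∷ x s (≤-trans (s≤s z≤n) a<r)) eq
  unchanged′ : ∀ r → r ≢ suc spot → occupant (x ∷ s') r ≡ occupant (x ∷ s) r
  unchanged′ zero _ = refl
  unchanged′ (suc zero) _ = refl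
  unchanged′ (suc (suc r)) r≢spot = unchanged (suc r) (λ eq → r≢spot (cong suc eq))

ParksAfter-lower : ∀ {a c s s'} → ParksAfter (suc a) c s s' → Occupied s (suc a) → ParksAfter a c s s'
ParksAfter-lower {a} {c} {s} {s'} P occ = record
  { spot = spot
  ; a<spot = <-trans (n<1+n a) a<spot
  ; wasEmpty = wasEmpty
  ; parked = parked
  ; gapless = gapless′
  ; unchanged = unchanged
  ; length≡ = length≡
  }
  where
  open ParksAfter P
  gapless′ : ∀ r → a < r → r < spot → Occupied s r
  gapless′ r a<r r<spot with r ≟ suc a
  ... | yes refl = occ
  ... | no r≢1+a = gapless r (≤∧≢⇒< a<r (λ eq → r≢1+a (sym eq))) r<spot

firstEmpty-spec : ∀ c s s' → firstEmpty c s ≡ just s' → ParksAfter 0 c s s'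
firstEmpty-spec c (nothing ∷ s) s' refl = record
  { spot = 1 ; a<spot = z<s ; wasEmpty = refl ; parked = refl
  ; gapless = λ { (suc r) _ (s≤s ()) }
  ; unchanged = unchanged ; length≡ = refl }
  where
  unchanged : ∀ r → r ≢ 1 → occupant (just c ∷ s) r ≡ occupant (nothing ∷ s) r
  unchanged zero _ = refl
  unchanged (suc zero) r≢1 = ⊥-elim (r≢1 refl)
  unchanged (suc (suc r)) _ = refl
firstEmpty-spec c (just x ∷ s) s' eq with >>=-just (firstEmpty c s) _ eq
... | s″ , eq′ , refl = ParksAfter-lower (ParksAfter-∷ (just x) (firstEmpty-spec c s s″ eq′)) (x , refl)

firstEmptyAfter-spec : ∀ a c s s' → firstEmptyAfter a c s ≡ just s' → ParksAfter a c s s'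
firstEmptyAfter-spec zero c s s' eq = firstEmpty-spec c s s' eq
firstEmptyAfter-spec (suc a) c (x ∷ s) s' eq with >>=-just (firstEmptyAfter a c s) _ eq
... | s″ , eq′ , refl = ParksAfter-∷ x (firstEmptyAfter-spec a c s s″ eq′)

record Bumped (a y : ℕ) (s s' : Config) : Set where
  constructor bumped
  field
    spot     : ℕ
    a<spot   : a < spot
    wasEmpty : occupant s spot ≡ nothing
    parked   : occupant s' spot ≡ just y
    gapless  : ∀ r → a < r → r < spot → Occupied s r

record StepSpec (i a : ℕ) (s s' : Config) : Set where
  field
    parks    : occupant s' a ≡ just i
    keeps    : ∀ r z → r ≢ a → occupant s r ≡ just z → occupant s' r ≡ just z
    bumps    : ∀ y → occupant s a ≡ just y → Bumped a y s s'
    newcomer : ∀ r z → occupant s' r ≡ just z → z ≡ i ⊎ ∃ λ r' → occupant s r' ≡ just z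
    length≡  : length s' ≡ length s

mvpStep-spec : ∀ i a s s' → 1 ≤ a → a ≤ length s → mvpStep i a s ≡ just s' → StepSpec i a s s'
mvpStep-spec i a s s' 1≤a a≤∣s∣ eq with occupant s a in occ
... | nothing with refl ← eq = record
  { parks = here
  ; keeps = λ r z r≢a eq′ → trans (occupant-setSpot-≢ s a i r r≢a) eq′
  ; bumps = λ y eq′ → ⊥-elim (nothing≢just (trans (sym occ) eq′))
  ; newcomer = newcomer
  ; length≡ = length-setSpot s a i
  }
  where
  here : occupant (setSpot s a i) a ≡ just i
  here = occupant-setSpot-≡ s a i 1≤a a≤∣s∣
  newcomer : ∀ r z → occupant (setSpot s a i) r ≡ just z → z ≡ i ⊎ ∃ λ r' → occupant s r' ≡ just z
  newcomer r z eq′ with r ≟ a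
  ... | yes refl = inj₁ (just-injective (trans (sym eq′) here))
  ... | no r≢a = inj₂ (r , trans (sym (occupant-setSpot-≢ s a i r r≢a)) eq′)
... | just y = record
  { parks = trans (unchanged a (<⇒≢ a<spot)) here
  ; keeps = keeps
  ; bumps = bumps
  ; newcomer = newcomer
  ; length≡ = trans length≡ (length-setSpot s a i)
  }
  where
  open ParksAfter (firstEmptyAfter-spec a y (setSpot s a i) s' eq)
  here : occupant (setSpot s a i) a ≡ just i
  here = occupant-setSpot-≡ s a i 1≤a a≤∣s∣
  spot≢a : spot ≢ a
  spot≢a = ≢-sym (<⇒≢ a<spot)
  keeps : ∀ r z → r ≢ a → occupant s r ≡ just z → occupant s' r ≡ just z
  keeps r z r≢a eq′ with r ≟ spot
  ... | yes refl =
    ⊥-elim (nothing≢just (trans (sym wasEmpty) (trans (occupant-setSpot-≢ s a i r r≢a) eq′)))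
  ... | no r≢spot = trans (unchanged r r≢spot) (trans (occupant-setSpot-≢ s a i r r≢a) eq′)
  bumps : ∀ y′ → occupant s a ≡ just y′ → Bumped a y′ s s'
  bumps y′ eq′ with refl ← just-injective (trans (sym occ) eq′) = bumped spot a<spot
    (trans (sym (occupant-setSpot-≢ s a i spot spot≢a)) wasEmpty) parked
    λ r a<r r<spot →
      map₂ (trans (sym (occupant-setSpot-≢ s a i r (≢-sym (<⇒≢ a<r))))) (gapless r a<r r<spot)
  newcomer : ∀ r z → occupant s' r ≡ just z → z ≡ i ⊎ ∃ λ r' → occupant s r' ≡ just z
  newcomer r z eq′ with r ≟ spot
  ... | yes refl = inj₂ (a , trans occ (cong just (just-injective (trans (sym parked) eq′))))
  ... | no r≢spot with r ≟ a
  ...   | yes refl = inj₁ (just-injective (trans (sym eq′) (trans (unchanged r r≢spot) here)))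
  ...   | no r≢a =
    inj₂ (r , trans (sym (occupant-setSpot-≢ s a i r r≢a)) (trans (sym (unchanged r r≢spot)) eq′))

Occupied-step : ∀ {i a s s' r} → StepSpec i a s s' → Occupied s r → Occupied s' r
Occupied-step {i} {a} {r = r} step (z , occ) with r ≟ a
... | yes refl = i , StepSpec.parks step
... | no r≢a = z , StepSpec.keeps step r z r≢a occ

data Run : ℕ → List ℕ → Config → Config → Set where
  []  : ∀ {k s} → Run k [] s s
  _∷_ : ∀ {k a as s s' sf} → StepSpec k a s s' → Run (suc k) as s' sf → Run k (a ∷ as) s sf

mvpRun-Run : ∀ {n} k as s sf → length s ≡ n → All (λ a → 1 ≤ a × a ≤ n) as →
             mvpRun k as s ≡ just sf → Run k as s sf
mvpRun-Run k [] s sf _ _ refl = []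
mvpRun-Run k (a ∷ as) s sf ∣s∣≡n ((1≤a , a≤n) ∷ as-ok) eq with >>=-just (mvpStep k a s) _ eq
... | s' , step , run =
  spec ∷ mvpRun-Run (suc k) as s' sf (trans (StepSpec.length≡ spec) ∣s∣≡n) as-ok run
  where
  spec : StepSpec k a s s'
  spec = mvpStep-spec k a s s' 1≤a (subst (a ≤_) (sym ∣s∣≡n) a≤n) step

Run-++ : ∀ {k ys s sf} xs → Run k (xs ++ ys) s sf →
         ∃ λ s₁ → Run k xs s s₁ × Run (k + length xs) ys s₁ sf
Run-++ {k} {ys} {s} {sf} [] run = s , [] , subst (λ m → Run m ys s sf) (sym (+-identityʳ k)) run
Run-++ {k} {ys} {sf = sf} (x ∷ xs) (step ∷ run) with Run-++ xs run
... | s₁ , run₁ , run₂ =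
  s₁ , step ∷ run₁ , subst (λ m → Run m ys s₁ sf) (sym (+-suc k (length xs))) run₂

Run-moves-right : ∀ {k as s sf p c} → Run k as s sf → occupant s p ≡ just c →
                  ∃ λ p' → p ≤ p' × occupant sf p' ≡ just c
Run-moves-right {p = p} [] occ = p , ≤-refl , occ
Run-moves-right {as = a ∷ _} {p = p} {c} (step ∷ run) occ with p ≟ a
... | no p≢a = Run-moves-right run (StepSpec.keeps step p c p≢a occ)
... | yes refl with StepSpec.bumps step c occ
...   | bumped q p<q _ parked _ with Run-moves-right run parked
...     | p' , q≤p' , occ′ = p' , ≤-trans (<⇒≤ p<q) q≤p' , occ′

Run-keeps : ∀ {k as s sf p c} → Run k as s sf → All (_< p) as →
            occupant s p ≡ just c → occupant sf p ≡ just c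
Run-keeps [] _ occ = occ
Run-keeps {p = p} {c} (step ∷ run) (a<p ∷ as<p) occ =
  Run-keeps run as<p (StepSpec.keeps step p c (≢-sym (<⇒≢ a<p)) occ)

CarsBelow : Config → ℕ → Set
CarsBelow s k = ∀ r z → occupant s r ≡ just z → z < k

StepSpec-CarsBelow : ∀ {i a s s'} → StepSpec i a s s' → CarsBelow s i → CarsBelow s' (suc i)
StepSpec-CarsBelow step below r z occ with StepSpec.newcomer step r z occ
... | inj₁ refl = ≤-refl
... | inj₂ (r' , occ′) = m≤n⇒m≤1+n (below r' z occ′)

Run-CarsBelow : ∀ {k as s sf} → Run k as s sf → CarsBelow s k → CarsBelow sf (k + length as)
Run-CarsBelow {k} {s = s} [] below = subst (CarsBelow s) (sym (+-identityʳ k)) below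
Run-CarsBelow {k} {_ ∷ as} {sf = sf} (step ∷ run) below =
  subst (CarsBelow sf) (sym (+-suc k (length as))) (Run-CarsBelow run (StepSpec-CarsBelow step below))

occupant-decreasing : ∀ m s p c → allFilled s ≡ just (decreasing m) →
                      occupant s p ≡ just c → p + c ≡ suc m
occupant-decreasing m (just c₀ ∷ s) p c filled occ with >>=-just (allFilled s) _ filled
occupant-decreasing (suc m) (just c₀ ∷ s) (suc zero) c filled refl | _ , _ , refl = refl
occupant-decreasing (suc m) (just c₀ ∷ s) (suc (suc p)) c filled occ | _ , filled′ , refl =
  cong suc (occupant-decreasing m s (suc p) c filled′ occ)

-- For the outcome (n, …, 1): the entry with r entries after it belongs to the car that ends in
-- spot r + 1, and no car ends before the spot it prefers.
Staircase : List ℕ → Set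
Staircase [] = ⊤
Staircase (x ∷ v) = x ≤ suc (length v) × Staircase v

Staircase-++⁻ʳ : ∀ xs {ys} → Staircase (xs ++ ys) → Staircase ys
Staircase-++⁻ʳ [] stair = stair
Staircase-++⁻ʳ (x ∷ xs) (_ , stair) = Staircase-++⁻ʳ xs stair

Staircase⇒≤length : ∀ v → Staircase v → All (_≤ length v) v
Staircase⇒≤length [] _ = []
Staircase⇒≤length (x ∷ v) (x≤ , stair) = x≤ ∷ All.map m≤n⇒m≤1+n (Staircase⇒≤length v stair)

Run-Staircase : ∀ {n k v s sf} → Run k v s sf → allFilled sf ≡ just (decreasing n) →
                k + length v ≡ suc n → Staircase v
Run-Staircase [] _ _ = tt
Run-Staircase {n} {k} {x ∷ v} {sf = sf} (step ∷ run) filled k+∣v∣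
  with Run-moves-right run (StepSpec.parks step)
... | p , x≤p , occ =
  subst (x ≤_) p≡ x≤p , Run-Staircase run filled (trans (sym (+-suc k (length v))) k+∣v∣)
  where
  p≡ : p ≡ suc (length v)
  p≡ = +-cancelˡ-≡ k p (suc (length v))
         (trans (+-comm k p) (trans (occupant-decreasing n sf p k filled occ) (sym k+∣v∣)))

count-∷-≡ : ∀ x v → count x (x ∷ v) ≡ suc (count x v)
count-∷-≡ x v with x ≟ x
... | yes _ = refl
... | no x≢x = ⊥-elim (x≢x refl)

count-∷-≢ : ∀ {x j} v → x ≢ j → count j (x ∷ v) ≡ count j v
count-∷-≢ {x} {j} v x≢j with x ≟ j
... | yes x≡j = ⊥-elim (x≢j x≡j)
... | no _ = refl

count-∷-≤ : ∀ j x v → count j (x ∷ v) ≤ suc (count j v)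
count-∷-≤ j x v with x ≟ j
... | yes _ = ≤-refl
... | no _ = n≤1+n _

count-++ : ∀ j xs ys → count j (xs ++ ys) ≡ count j xs + count j ys
count-++ j [] ys = refl
count-++ j (x ∷ xs) ys with x ≟ j
... | yes _ = cong suc (count-++ j xs ys)
... | no _ = count-++ j xs ys

count-absent : ∀ {j} v → All (_< j) v → count j v ≡ 0
count-absent [] _ = refl
count-absent (x ∷ v) (x<j ∷ v<j) = trans (count-∷-≢ v (<⇒≢ x<j)) (count-absent v v<j)

module AtSpot (j : ℕ) where

  record Displaced (s : Config) : Set where
    constructor displaced
    field
      older newer spot : ℕ
      atJ         : occupant s j ≡ just newer
      atSpot      : occupant s spot ≡ just older
      older<newer : older < newer
      j<spot      : j < spot
      block       : ∀ r → j ≤ r → r ≤ spot → Occupied s r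

  -- c is the number of cars so far that preferred spot j.
  Inv : Config → ℕ → Set
  Inv s c = (1 ≤ c → Occupied s j) × (2 ≤ c → Displaced s)

  Inv-step-≢ : ∀ {k a s s'} c → StepSpec k a s s' → a ≢ j → Inv s c → Inv s' c
  Inv-step-≢ {a = a} {s} {s'} c step a≢j (occupied , disp) = Occupied-step step ∘ occupied , disp′ ∘ disp
    where
    open StepSpec step
    disp′ : Displaced s → Displaced s'
    disp′ (displaced x y p atJ atP x<y j<p block) with p ≟ a
    ... | no p≢a = displaced x y p (keeps j y (≢-sym a≢j) atJ) (keeps p x p≢a atP) x<y j<p
                     λ r j≤r r≤p → Occupied-step step (block r j≤r r≤p)
    ... | yes refl with bumps x atP
    ...   | bumped q p<q _ parked gapless =
      displaced x y q (keeps j y (≢-sym a≢j) atJ) parked x<y (<-trans j<p p<q) block′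
      where
      block′ : ∀ r → j ≤ r → r ≤ q → Occupied s' r
      block′ r j≤r r≤q with r ≤? p | r ≟ q
      ... | yes r≤p | _ = Occupied-step step (block r j≤r r≤p)
      ... | no _ | yes refl = x , parked
      ... | no r≰p | no r≢q = Occupied-step step (gapless r (≰⇒> r≰p) (≤∧≢⇒< r≤q r≢q))

  Inv-step-≡ : ∀ {k s s'} c → StepSpec k j s s' → CarsBelow s k → Inv s c → Inv s' (suc c)
  Inv-step-≡ {k} {s} {s'} c step below (occupied , _) = (λ _ → k , parks) , disp′
    where
    open StepSpec step
    disp′ : 2 ≤ suc c → Displaced s'
    disp′ (s≤s 1≤c) with occupied 1≤c
    ... | y , atJ with bumps y atJ
    ...   | bumped q j<q _ parked gapless = displaced y k q parks parked (below j y atJ) j<q block′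
      where
      block′ : ∀ r → j ≤ r → r ≤ q → Occupied s' r
      block′ r j≤r r≤q with m≤n⇒m<n∨m≡n j≤r | r ≟ q
      ... | inj₂ refl | _ = Occupied-step step (y , atJ)
      ... | inj₁ _ | yes refl = y , parked
      ... | inj₁ j<r | no r≢q = Occupied-step step (gapless r j<r (≤∧≢⇒< r≤q r≢q))

  Inv-run : ∀ {k v s sf} c → Run k v s sf → CarsBelow s k → Inv s c → Inv sf (c + count j v)
  Inv-run {s = s} c [] _ inv = subst (Inv s) (sym (+-identityʳ c)) inv
  Inv-run {v = a ∷ v} {sf = sf} c (step ∷ run) below inv with a ≟ j
  ... | yes refl = subst (Inv sf) (sym (+-suc c (count j v)))
                     (Inv-run (suc c) run (StepSpec-CarsBelow step below) (Inv-step-≡ c step below inv))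
  ... | no a≢j = Inv-run c run (StepSpec-CarsBelow step below) (Inv-step-≢ c step a≢j inv)

  -- Car T is the one that ends in spot j, and s₂ already has the final occupants of spots j, j+1, ….
  Displaced-contradiction : ∀ {n T a s₁ s₂} → j + T ≡ suc n → StepSpec T a s₁ s₂ → CarsBelow s₁ T →
    (∀ r z → j ≤ r → occupant s₂ r ≡ just z → r + z ≡ suc n) → ¬ Displaced s₁
  Displaced-contradiction {n} {T} {a} j+T step below final (displaced x y p atJ atP x<y j<p block) with a ≟ j
  ... | no a≢j =
    <⇒≢ (below j y atJ) (+-cancelˡ-≡ j y T (trans (final j y ≤-refl (keeps j y (≢-sym a≢j) atJ)) (sym j+T)))
    where open StepSpec step
  ... | yes refl with StepSpec.bumps step y atJ
  ...   | bumped q j<q wasEmpty parked _ = <-irrefl refl (subst₂ _<_ p+x q+y (+-mono-< p<q x<y))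
    where
    p<q : p < q
    p<q with q ≤? p
    ... | no q≰p = ≰⇒> q≰p
    ... | yes q≤p with block q (<⇒≤ j<q) q≤p
    ...   | _ , occ = ⊥-elim (nothing≢just (trans (sym wasEmpty) occ))
    p+x : p + x ≡ suc n
    p+x = final p x (<⇒≤ j<p) (StepSpec.keeps step p x (≢-sym (<⇒≢ j<p)) atP)
    q+y : q + y ≡ suc n
    q+y = final q y (<⇒≤ j<q) parked

splitAround : ∀ m l (v : List ℕ) → length v ≡ m + suc l →
  ∃ λ pre → ∃ λ a → ∃ λ post → v ≡ pre ++ a ∷ post × length pre ≡ m × length post ≡ l
splitAround zero l (a ∷ post) ∣v∣ = [] , a , post , refl , refl , suc-injective ∣v∣
splitAround (suc m) l (x ∷ v) ∣v∣ with splitAround m l v (suc-injective ∣v∣)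
... | pre , a , post , refl , ∣pre∣ , ∣post∣ = x ∷ pre , a , post , refl , cong suc ∣pre∣ , ∣post∣

count≤2 : ∀ n v sf → length v ≡ n → Run 1 v (emptyConfig n) sf → allFilled sf ≡ just (decreasing n) →
          Staircase v → ∀ j → 1 ≤ j → j ≤ n → count j v ≤ 2
count≤2 n v sf ∣v∣ run filled stair (suc j′) _ j≤n
  with splitAround (n ∸ suc j′) j′ v (trans ∣v∣ (sym (m∸n+n≡m j≤n)))
... | pre , a , post , refl , ∣pre∣ , ∣post∣ with Run-++ pre run
... | s₁ , run₁ , _∷_ {s' = s₂} step run₂ = begin
  count j (pre ++ a ∷ post)        ≡⟨ count-++ j pre (a ∷ post) ⟩
  count j pre + count j (a ∷ post) ≤⟨ +-mono-≤ pre≤1 (count-∷-≤ j a post) ⟩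
  1 + suc (count j post)           ≡⟨ cong (λ m → 2 + m) (count-absent post post<j) ⟩
  2                                ∎
  where
  open ≤-Reasoning
  j : ℕ
  j = suc j′
  open AtSpot j
  j+T : j + suc (length pre) ≡ suc n
  j+T = trans (+-suc j (length pre)) (cong suc (trans (cong (j +_) ∣pre∣) (m+[n∸m]≡n j≤n)))
  post<j : All (_< j) post
  post<j = All.map (λ x≤ → s≤s (subst (_ ≤_) ∣post∣ x≤))
                   (Staircase⇒≤length post (proj₂ (Staircase-++⁻ʳ pre stair)))
  final : ∀ r z → j ≤ r → occupant s₂ r ≡ just z → r + z ≡ suc n
  final r z j≤r occ =
    occupant-decreasing n sf r z filled (Run-keeps run₂ (All.map (λ x<j → <-≤-trans x<j j≤r) post<j) occ)
  empty-below : CarsBelow (emptyConfig n) 1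
  empty-below r z occ = ⊥-elim (nothing≢just (trans (sym (occupant-emptyConfig n r)) occ))
  inv : Inv s₁ (count j pre)
  inv = Inv-run 0 run₁ empty-below ((λ ()) , (λ ()))
  pre≤1 : count j pre ≤ 1
  pre≤1 with 2 ≤? count j pre
  ... | yes 2≤c =
    ⊥-elim (Displaced-contradiction j+T step (Run-CarsBelow run₁ empty-below) final (proj₂ inv 2≤c))
  ... | no 2≰c = ≤-pred (≰⇒> 2≰c)

countsUpTo : ℕ → List ℕ → ℕ
countsUpTo k v = sum (applyUpTo (λ i → count (suc i) v) k)

countsUpTo-suc : ∀ k v → countsUpTo (suc k) v ≡ countsUpTo k v + count (suc k) v
countsUpTo-suc k v = begin
  sum (applyUpTo c (suc k))         ≡⟨ cong sum (applyUpTo-∷ʳ c k) ⟨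
  sum (applyUpTo c k ∷ʳ c k)        ≡⟨ sum-++ (applyUpTo c k) (c k ∷ []) ⟩
  sum (applyUpTo c k) + (c k + 0)   ≡⟨ cong (sum (applyUpTo c k) +_) (+-identityʳ (c k)) ⟩
  sum (applyUpTo c k) + c k         ∎
  where
  open ≡-Reasoning
  c : ℕ → ℕ
  c i = count (suc i) v

countsUpTo-∷-> : ∀ k x v → k < x → countsUpTo k (x ∷ v) ≡ countsUpTo k v
countsUpTo-∷-> zero x v _ = refl
countsUpTo-∷-> (suc k) x v k<x = begin
  countsUpTo (suc k) (x ∷ v)                    ≡⟨ countsUpTo-suc k (x ∷ v) ⟩
  countsUpTo k (x ∷ v) + count (suc k) (x ∷ v)  ≡⟨ cong₂ _+_ (countsUpTo-∷-> k x v (<-trans (n<1+n k) k<x))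
                                                             (count-∷-≢ v (≢-sym (<⇒≢ k<x))) ⟩
  countsUpTo k v + count (suc k) v              ≡⟨ countsUpTo-suc k v ⟨
  countsUpTo (suc k) v                          ∎
  where open ≡-Reasoning

countsUpTo-∷-≤ : ∀ k x v → 1 ≤ x → x ≤ k → countsUpTo k (x ∷ v) ≡ suc (countsUpTo k v)
countsUpTo-∷-≤ zero (suc x) v _ ()
countsUpTo-∷-≤ (suc k) x v 1≤x x≤1+k = begin
  countsUpTo (suc k) (x ∷ v)                    ≡⟨ countsUpTo-suc k (x ∷ v) ⟩
  countsUpTo k (x ∷ v) + count (suc k) (x ∷ v)  ≡⟨ step (x ≟ suc k) ⟩
  suc (countsUpTo k v + count (suc k) v)        ≡⟨ cong suc (countsUpTo-suc k v) ⟨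
  suc (countsUpTo (suc k) v)                    ∎
  where
  open ≡-Reasoning
  step : Dec (x ≡ suc k) →
         countsUpTo k (x ∷ v) + count (suc k) (x ∷ v) ≡ suc (countsUpTo k v + count (suc k) v)
  step (yes refl) = begin
    countsUpTo k (x ∷ v) + count x (x ∷ v) ≡⟨ cong₂ _+_ (countsUpTo-∷-> k x v ≤-refl) (count-∷-≡ x v) ⟩
    countsUpTo k v + suc (count x v)       ≡⟨ +-suc _ _ ⟩
    suc (countsUpTo k v + count x v)       ∎
  step (no x≢1+k) =
    cong₂ _+_ (countsUpTo-∷-≤ k x v 1≤x (≤-pred (≤∧≢⇒< x≤1+k x≢1+k))) (count-∷-≢ v x≢1+k)

countsUpTo-≤-suc : ∀ k v → countsUpTo k v ≤ countsUpTo (suc k) v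
countsUpTo-≤-suc k v = subst (countsUpTo k v ≤_) (sym (countsUpTo-suc k v)) (m≤m+n _ _)

countsUpTo-≤-∷ : ∀ k x v → 1 ≤ x → countsUpTo k v ≤ countsUpTo k (x ∷ v)
countsUpTo-≤-∷ k x v 1≤x with x ≤? k
... | yes x≤k = subst (countsUpTo k v ≤_) (sym (countsUpTo-∷-≤ k x v 1≤x x≤k)) (n≤1+n _)
... | no x≰k = ≤-reflexive (sym (countsUpTo-∷-> k x v (≰⇒> x≰k)))

countsUpTo-[] : ∀ k → countsUpTo k [] ≡ 0
countsUpTo-[] zero = refl
countsUpTo-[] (suc k) = trans (countsUpTo-suc k []) (trans (+-identityʳ _) (countsUpTo-[] k))

countsUpTo-length : ∀ n v → All (λ a → 1 ≤ a × a ≤ n) v → countsUpTo n v ≡ length v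
countsUpTo-length n [] _ = countsUpTo-[] n
countsUpTo-length n (x ∷ v) ((1≤x , x≤n) ∷ v-ok) =
  trans (countsUpTo-∷-≤ n x v 1≤x x≤n) (cong suc (countsUpTo-length n v v-ok))

countsUpTo-Staircase : ∀ v → Staircase v → All (1 ≤_) v → ∀ k → k ≤ length v → k ≤ countsUpTo k v
countsUpTo-Staircase [] _ _ zero _ = z≤n
countsUpTo-Staircase (x ∷ v) (x≤ , stair) (1≤x ∷ v-pos) k k≤ with m≤n⇒m<n∨m≡n k≤
... | inj₁ k<1+∣v∣ =
  ≤-trans (countsUpTo-Staircase v stair v-pos k (≤-pred k<1+∣v∣)) (countsUpTo-≤-∷ k x v 1≤x)
... | inj₂ refl = begin
  suc (length v)                          ≤⟨ s≤s (countsUpTo-Staircase v stair v-pos (length v) ≤-refl) ⟩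
  suc (countsUpTo (length v) v)           ≤⟨ s≤s (countsUpTo-≤-suc (length v) v) ⟩
  suc (countsUpTo (suc (length v)) v)     ≡⟨ countsUpTo-∷-≤ (suc (length v)) x v 1≤x x≤ ⟨
  countsUpTo (suc (length v)) (x ∷ v)     ∎
  where open ≤-Reasoning

StaysAboveEndsAt0-φ∷ : ∀ c h h' p → c ≤ 2 → c + h ≡ suc h' → StaysAboveEndsAt0 h' p →
                       StaysAboveEndsAt0 h (φ c ∷ p)
StaysAboveEndsAt0-φ∷ zero (suc h) h p _ refl above = above
StaysAboveEndsAt0-φ∷ (suc zero) h h p _ refl above = above
StaysAboveEndsAt0-φ∷ (suc (suc zero)) h (suc h) p _ refl above = above
StaysAboveEndsAt0-φ∷ (suc (suc (suc _))) _ _ _ (s≤s (s≤s ()))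

+-regroup : ∀ h c {m S} → c + h ≡ m → h + (c + S) ≡ m + S
+-regroup h c {S = S} eq = trans (sym (+-assoc h c S)) (cong (_+ S) (trans (+-comm h c) eq))

-- Step i goes from height h to h + c i − 1, so the heights are h + (c 0 + ⋯ + c (k−1)) − k.
StaysAboveEndsAt0-φ : ∀ r h (c : ℕ → ℕ) → (∀ i → i < r → c i ≤ 2) →
  (∀ k → k ≤ r → k ≤ h + sum (applyUpTo c k)) → h + sum (applyUpTo c r) ≡ r →
  StaysAboveEndsAt0 h (applyUpTo (φ ∘ c) r)
StaysAboveEndsAt0-φ zero h c _ _ end = trans (sym (+-identityʳ h)) end
StaysAboveEndsAt0-φ (suc r) h c bound prefix end with c 0 + h in eq
... | zero = contradiction (subst (1 ≤_) (+-regroup h (c 0) eq) (prefix 1 (s≤s z≤n))) λ ()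
... | suc h' = StaysAboveEndsAt0-φ∷ (c 0) h h' _ (bound 0 z<s) eq
  (StaysAboveEndsAt0-φ r h' (c ∘ suc) (λ i i<r → bound (suc i) (s≤s i<r))
    (λ k k≤r → ≤-pred (subst (suc k ≤_) (+-regroup h (c 0) eq) (prefix (suc k) (s≤s k≤r))))
    (suc-injective (trans (sym (+-regroup h (c 0) eq)) end)))

proposition4p9 : (n : ℕ) (α : Vec ℕ n) → IsMVPParkingFunction α →
    outcomeMVP α ≡ just (decreasing n) → InMotzkin n (Φ α)
proposition4p9 n α (inRange , _) outcome with >>=-just (mvpRun 1 (toList α) (emptyConfig n)) allFilled outcome
... | sf , ran , filled = subst (InMotzkin n) (sym (map-upTo _ n))
        (length-applyUpTo _ n , StaysAboveEndsAt0-φ n 0 c bounded prefix total)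
  where
  v : List ℕ
  v = toList α
  c : ℕ → ℕ
  c i = count (suc i) v
  ∣v∣ : length v ≡ n
  ∣v∣ = length-toList α
  run : Run 1 v (emptyConfig n) sf
  run = mvpRun-Run 1 v (emptyConfig n) sf (length-emptyConfig n) inRange ran
  stair : Staircase v
  stair = Run-Staircase run filled (cong suc ∣v∣)
  bounded : ∀ i → i < n → c i ≤ 2
  bounded i i<n = count≤2 n v sf ∣v∣ run filled stair (suc i) (s≤s z≤n) i<n
  prefix : ∀ k → k ≤ n → k ≤ countsUpTo k v
  prefix k k≤n = countsUpTo-Staircase v stair (All.map proj₁ inRange) k (subst (k ≤_) (sym ∣v∣) k≤n)
  total : countsUpTo n v ≡ n
  total = trans (countsUpTo-length n v inRange) ∣v∣
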